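{- Let $R$ be a Riesz space with strong unit $1$, and let $m$ be a model of the geometric theory $\mathrm{Max}(R)$ (a point of the locale). For $a\in R$ set $\sigma_m(a):=(\{r\in\mathbb{Q}: m\models D(a-r)\},\ \{s\in\mathbb{Q}: m\models D(s-a)\})$. Then $\sigma_m$ is a representation of $R$, i.e. a Riesz morphism $R\to\mathbb{R}$ into the Dedekind reals, with $\sigma_m(1)=1$.
   Context: A Riesz space is a $\mathbb{Q}$-vector space with a compatible lattice order; $1$ is a strong unit if every $x$ satisfies $-n1\le x\le n1$ for some $n$; rationals $r$ are identified with $r1$. $\mathrm{Max}(R)$ is the propositional geometric theory with generators $D(a)$, $a\in R$, and relations: $D(1)=1$; $D(a)\wedge D(-a)=0$; $D(a+b)\le D(a)\vee D(b)$; $D(a)=0$ if $a\le0$; $D(a\vee b)=D(a)\vee D(b)$; $D(a)=\bigvee_{s>0}D(a-s)$ ($s$ rational). A Dedekind real is a pair (lower cut, upper cut) of rationals in the usual sense; a Riesz morphism is a linear map preserving $\vee$. -}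

module Defs where

open import Level using (Level; _⊔_; suc)
open import Data.Nat using (ℕ)
open import Data.Integer using (+_)
open import Data.Rational using (ℚ; 0ℚ; 1ℚ; _/_)
  renaming (_≤_ to _≤ℚ_; _<_ to _<ℚ_; _+_ to _+ℚ_; _*_ to _*ℚ_; -_ to -ℚ_)
open import Data.Product using (Σ; _×_; ∃; ∃-syntax)
open import Data.Sum using (_⊎_)
open import Data.Empty using (⊥)
open import Relation.Nullary using (¬_)
open import Relation.Binary.PropositionalEquality using (_≡_)

record RieszSpace (c ℓ : Level) : Set (suc (c ⊔ ℓ)) where
  infixl 6 _+_ _-_
  infixl 7 _·_
  infix 4 _≤_
  field
    Carrier : Set c
    _+_     : Carrier → Carrier → Carrier
    0#      : Carrier
    -_      : Carrier → Carrier
    _·_     : ℚ → Carrier → Carrier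
    _∨_     : Carrier → Carrier → Carrier
    _≤_     : Carrier → Carrier → Set ℓ
    +-assoc    : ∀ a b d → (a + b) + d ≡ a + (b + d)
    +-comm     : ∀ a b → a + b ≡ b + a
    +-identity : ∀ a → a + 0# ≡ a
    +-inverse  : ∀ a → a + (- a) ≡ 0#
    ·-distrib-+   : ∀ q a b → q · (a + b) ≡ q · a + q · b
    ·-distrib-+ℚ  : ∀ p q a → (p +ℚ q) · a ≡ p · a + q · a
    ·-assoc       : ∀ p q a → (p *ℚ q) · a ≡ p · (q · a)
    ·-identity    : ∀ a → 1ℚ · a ≡ a
    ≤-refl    : ∀ a → a ≤ a
    ≤-trans   : ∀ {a b d} → a ≤ b → b ≤ d → a ≤ d
    ≤-antisym : ∀ {a b} → a ≤ b → b ≤ a → a ≡ b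
    -- binary joins (meets then exist as a ∧ b = -((-a) ∨ (-b)))
    ∨-upperˡ : ∀ a b → a ≤ a ∨ b
    ∨-upperʳ : ∀ a b → b ≤ a ∨ b
    ∨-least  : ∀ {a b d} → a ≤ d → b ≤ d → a ∨ b ≤ d
    +-mono-≤ : ∀ {a b} d → a ≤ b → a + d ≤ b + d
    ·-mono-≤ : ∀ {a b} q → 0ℚ ≤ℚ q → a ≤ b → q · a ≤ q · b

  _-_ : Carrier → Carrier → Carrier
  a - b = a + (- b)

ℕ→ℚ : ℕ → ℚ
ℕ→ℚ n = (+ n) / 1

module _ {c ℓ : Level} (R : RieszSpace c ℓ) where
  open RieszSpace R

  IsStrongUnit : Carrier → Set (c ⊔ ℓ)
  IsStrongUnit u = ∀ x → ∃[ n ] ((- (ℕ→ℚ n · u) ≤ x) × (x ≤ ℕ→ℚ n · u))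

  -- A model (point) of the propositional geometric theory Max(R),
  -- for the unit u (rationals r are identified with r · u).
  record MaxModel (u : Carrier) (k : Level) : Set (c ⊔ ℓ ⊔ suc k) where
    field
      D       : Carrier → Set k
      D-one   : D u
      D-neg   : ∀ a → D a → D (- a) → ⊥
      D-add   : ∀ a b → D (a + b) → D a ⊎ D b
      D-nonpos : ∀ a → a ≤ 0# → ¬ D a
      D-join⇒ : ∀ a b → D (a ∨ b) → D a ⊎ D b
      D-join⇐ : ∀ a b → D a ⊎ D b → D (a ∨ b)
      D-round⇒ : ∀ a → D a → ∃[ s ] (0ℚ <ℚ s × D (a - s · u))
      D-round⇐ : ∀ a → (∃[ s ] (0ℚ <ℚ s × D (a - s · u))) → D a

record Cut (k : Level) : Set (suc k) where
  constructor cut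
  field
    L : ℚ → Set k
    U : ℚ → Set k
open Cut public

record IsDedekind {k} (x : Cut k) : Set k where
  field
    L-inhabited : ∃[ q ] L x q
    U-inhabited : ∃[ q ] U x q
    L-rounded⇒  : ∀ q → L x q → ∃[ r ] (q <ℚ r × L x r)
    L-rounded⇐  : ∀ q → (∃[ r ] (q <ℚ r × L x r)) → L x q
    U-rounded⇒  : ∀ q → U x q → ∃[ r ] (r <ℚ q × U x r)
    U-rounded⇐  : ∀ q → (∃[ r ] (r <ℚ q × U x r)) → U x q
    disjoint    : ∀ q → L x q → U x q → ⊥
    located     : ∀ q r → q <ℚ r → L x q ⊎ U x r

_≃ℝ_ : ∀ {k} → Cut k → Cut k → Set k
x ≃ℝ y = ∀ q → ((L x q → L y q) × (L y q → L x q))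
              × ((U x q → U y q) × (U y q → U x q))

ℚ→ℝ : ∀ {k} → ℚ → Cut k
ℚ→ℝ {k} p = cut (λ q → Level.Lift k (q <ℚ p)) (λ q → Level.Lift k (p <ℚ q))

_+ℝ_ : ∀ {k} → Cut k → Cut k → Cut k
x +ℝ y = cut (λ r → ∃[ p ] ∃[ q ] (L x p × L y q × r <ℚ p +ℚ q))
             (λ r → ∃[ p ] ∃[ q ] (U x p × U y q × p +ℚ q <ℚ r))

_·ℝ_ : ∀ {k} → ℚ → Cut k → Cut k
_·ℝ_ {k} q x = cut
  (λ r → (0ℚ <ℚ q × ∃[ s ] (L x s × r ≡ q *ℚ s))
       ⊎ ((Level.Lift k (q ≡ 0ℚ × r <ℚ 0ℚ))
       ⊎ (q <ℚ 0ℚ × ∃[ s ] (U x s × r ≡ q *ℚ s))))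
  (λ r → (0ℚ <ℚ q × ∃[ s ] (U x s × r ≡ q *ℚ s))
       ⊎ ((Level.Lift k (q ≡ 0ℚ × 0ℚ <ℚ r))
       ⊎ (q <ℚ 0ℚ × ∃[ s ] (L x s × r ≡ q *ℚ s))))

_∨ℝ_ : ∀ {k} → Cut k → Cut k → Cut k
x ∨ℝ y = cut (λ r → L x r ⊎ L y r) (λ r → U x r × U y r)

module _ {c ℓ : Level} (R : RieszSpace c ℓ) where
  open RieszSpace R

  σ : ∀ {u k} → MaxModel R u k → Carrier → Cut k
  σ {u} m a = cut (λ r → MaxModel.D m (a - r · u))
                  (λ s → MaxModel.D m (s · u - a))

  IsRepresentation : ∀ {k} → Carrier → (Carrier → Cut k) → Set (c ⊔ k)
  IsRepresentation u f =
      (∀ a → IsDedekind (f a))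
    × (∀ a b → f (a + b) ≃ℝ (f a +ℝ f b))
    × (∀ q a → f (q · a) ≃ℝ (q ·ℝ f a))
    × (∀ a b → f (a ∨ b) ≃ℝ (f a ∨ℝ f b))
    × (f u ≃ℝ ℚ→ℝ 1ℚ)

-- Each σ_m(a) is a Dedekind cut: roundedness is the axiom D(a) = ⋁_{s>0} D(a − s), disjointness
-- is D(a) ∧ D(−a) = 0, locatedness splits (r − q)·1 = (a − q) + (r − a) using D(x + y) ≤ D(x) ∨ D(y),
-- and the strong unit makes both cuts inhabited. Upper cuts of a are lower cuts of −a, so every
-- statement about upper cuts reduces to one about lower cuts. The hard half of additivity
-- approximates σ_m(a) within ε (from locatedness by an Archimedean walk) and splits
-- a + b − r = (a − s) + (b − (r − s)); scalars and the unit follow from D(q·a) = D(a) for q > 0,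
-- and joins from D(a ∨ b) = D(a) ∨ D(b).

module Submission where

open import Level using (Level; lift; lower)
open import Data.Nat as ℕ using (zero; suc)
import Data.Nat.Properties as ℕP
open import Data.Integer as ℤ using (+[1+_]; -[1+_])
import Data.Integer.Properties as ℤP
open import Data.Integer.Solver using () renaming (module +-*-Solver to ℤ-Solver)
open import Data.Nat.Coprimality using (1-coprimeTo) renaming (sym to coprime-sym)
open import Data.Rational as Q using (ℚ; mkℚ; 0ℚ; 1ℚ; toℚᵘ; 1/_)
  renaming (_<_ to _<ℚ_; _+_ to _+ℚ_; _*_ to _*ℚ_; -_ to -ℚ_; _-_ to _-ℚ_)
import Data.Rational.Properties as QP
open import Data.Rational.Solver using () renaming (module +-*-Solver to ℚ-Solver)
open import Data.Rational.Unnormalised as ℚᵘ using (mkℚᵘ; *≡*; *<*)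
import Data.Rational.Unnormalised.Properties as ℚᵘP
open import Data.Product using (∃₂; ∃-syntax; _×_; _,_; proj₁; proj₂)
open import Data.Sum using (_⊎_; inj₁; inj₂; [_,_]′)
open import Function using (id; _∘_)
open import Relation.Nullary using (¬_)
open import Data.Empty using (⊥; ⊥-elim)
open import Relation.Binary.Definitions using (tri<; tri≈; tri>)
open import Relation.Binary.PropositionalEquality
open import Algebra.Bundles using (AbelianGroup)
open import Algebra.Consequences.Propositional using (comm∧idʳ⇒id; comm∧invʳ⇒inv)
import Algebra.Properties.AbelianGroup as AbelianGroupProperties
import Algebra.Solver.CommutativeMonoid as CommutativeMonoidSolver
open import Defs

toℚᵘ-ℕ→ℚ : ∀ n → toℚᵘ (ℕ→ℚ n) ℚᵘ.≃ mkℚᵘ (ℤ.+ n) 0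
toℚᵘ-ℕ→ℚ n rewrite QP.normalize-coprime (coprime-sym (1-coprimeTo n)) = ℚᵘP.≃-refl

ℕ→ℚ-suc : ∀ n → ℕ→ℚ (suc n) ≡ ℕ→ℚ n +ℚ 1ℚ
ℕ→ℚ-suc n = QP.toℚᵘ-injective (begin
  toℚᵘ (ℕ→ℚ (suc n))                 ≈⟨ toℚᵘ-ℕ→ℚ (suc n) ⟩
  mkℚᵘ (ℤ.+ suc n) 0                 ≈⟨ *≡* (solve 1 (λ x → (one :+ x) :* one := (x :* one :+ one :* one) :* one)
                                                   refl (ℤ.+ n)) ⟩
  mkℚᵘ (ℤ.+ n) 0 ℚᵘ.+ mkℚᵘ (ℤ.+ 1) 0 ≈⟨ ℚᵘP.+-cong (toℚᵘ-ℕ→ℚ n) (toℚᵘ-ℕ→ℚ 1) ⟨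
  toℚᵘ (ℕ→ℚ n) ℚᵘ.+ toℚᵘ 1ℚ          ≈⟨ QP.toℚᵘ-homo-+ (ℕ→ℚ n) 1ℚ ⟨
  toℚᵘ (ℕ→ℚ n +ℚ 1ℚ)                 ∎)
  where
  open ℚᵘP.≃-Reasoning
  open ℤ-Solver
  one = con (ℤ.+ 1)

archimedean : ∀ x → ∃[ N ] x <ℚ ℕ→ℚ N
archimedean (mkℚ (ℤ.+ k) d _) = suc k , QP.toℚᵘ-cancel-<
  (ℚᵘP.<-respʳ-≃ (ℚᵘP.≃-sym (toℚᵘ-ℕ→ℚ (suc k)))
    (*<* (subst₂ ℤ._<_ (ℤP.pos-* k 1) (ℤP.pos-* (suc k) (suc d)) (ℤ.+<+ k<[1+k][1+d]))))
  where
  k<[1+k][1+d] : k ℕ.* 1 ℕ.< suc k ℕ.* suc d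
  k<[1+k][1+d] = ℕP.≤-trans (ℕ.s≤s (ℕP.≤-reflexive (ℕP.*-identityʳ k))) (ℕP.m≤m*n (suc k) (suc d))
archimedean (mkℚ -[1+ k ] d _) =
  0 , QP.toℚᵘ-cancel-< (ℚᵘP.<-respʳ-≃ (ℚᵘP.≃-sym (toℚᵘ-ℕ→ℚ 0)) (*<* ℤ.-<+))

positive⇒ratio : ∀ {q} → 0ℚ <ℚ q → ∃₂ λ d n → ℕ→ℚ (suc d) *ℚ q ≡ ℕ→ℚ (suc n)
positive⇒ratio {mkℚ +[1+ n ] d c} _ = d , n , QP.toℚᵘ-injective (begin
  toℚᵘ (ℕ→ℚ (suc d) *ℚ q)                ≈⟨ QP.toℚᵘ-homo-* (ℕ→ℚ (suc d)) q ⟩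
  toℚᵘ (ℕ→ℚ (suc d)) ℚᵘ.* toℚᵘ q         ≈⟨ ℚᵘP.*-congʳ (toℚᵘ-ℕ→ℚ (suc d)) ⟩
  mkℚᵘ (ℤ.+ suc d) 0 ℚᵘ.* mkℚᵘ +[1+ n ] d ≈⟨ *≡* eq ⟩
  mkℚᵘ (ℤ.+ suc n) 0                      ≈⟨ toℚᵘ-ℕ→ℚ (suc n) ⟨
  toℚᵘ (ℕ→ℚ (suc n))                      ∎)
  where
  open ℚᵘP.≃-Reasoning
  q = mkℚ +[1+ n ] d c
  eq : +[1+ d ] ℤ.* +[1+ n ] ℤ.* ℤ.+ 1 ≡ +[1+ n ] ℤ.* ℤ.+ (1 ℕ.* suc d)
  eq = trans (solve 2 (λ x y → x :* y :* con (ℤ.+ 1) := y :* x) refl +[1+ d ] +[1+ n ])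
             (cong (λ z → +[1+ n ] ℤ.* ℤ.+ z) (sym (ℕP.*-identityˡ (suc d))))
    where open ℤ-Solver
positive⇒ratio {mkℚ (ℤ.+ 0) _ _} (Q.*<* (ℤ.+<+ ()))
positive⇒ratio {mkℚ -[1+ _ ] _ _} (Q.*<* ())

<⇒0<- : ∀ {a b} → a <ℚ b → 0ℚ <ℚ b -ℚ a
<⇒0<- {a} {b} a<b = subst (_<ℚ b -ℚ a) (QP.+-inverseʳ a) (QP.+-monoˡ-< (-ℚ a) a<b)

0<-⇒< : ∀ {a b} → 0ℚ <ℚ b -ℚ a → a <ℚ b
0<-⇒< {a} {b} 0<b-a = subst₂ _<ℚ_ (QP.+-identityˡ a) (solve 2 (λ b a → b :- a :+ a := b) refl b a)
                        (QP.+-monoˡ-< a 0<b-a)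
  where open ℚ-Solver

p<p+q : ∀ x {ε} → 0ℚ <ℚ ε → x <ℚ x +ℚ ε
p<p+q x {ε} 0<ε = 0<-⇒< (subst (0ℚ <ℚ_) (solve 2 (λ x ε → ε := x :+ ε :- x) refl x ε) 0<ε)
  where open ℚ-Solver

archimedean-* : ∀ {δ} → 0ℚ <ℚ δ → ∀ x → ∃[ N ] x <ℚ ℕ→ℚ N *ℚ δ
archimedean-* {δ} 0<δ x = let N , x/δ<N = archimedean (x *ℚ 1/ δ) in
  N , subst (_<ℚ ℕ→ℚ N *ℚ δ) x/δ*δ≡x (QP.*-monoˡ-<-pos δ x/δ<N)
  where
  instance
    δ-positive = Q.positive 0<δ
    δ-nonZero = QP.pos⇒nonZero δ
  x/δ*δ≡x : x *ℚ 1/ δ *ℚ δ ≡ x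
  x/δ*δ≡x = trans (QP.*-assoc x (1/ δ) δ) (trans (cong (x *ℚ_) (QP.*-inverseˡ δ)) (QP.*-identityʳ x))

-<⇒<+ : ∀ {a b c} → a -ℚ b <ℚ c → a <ℚ b +ℚ c
-<⇒<+ {a} {b} {c} a-b<c = subst (_<ℚ b +ℚ c) (solve 2 (λ a b → b :+ (a :- b) := a) refl a b)
                            (QP.+-monoʳ-< b a-b<c)
  where open ℚ-Solver

divide : ∀ {q} → q ≢ 0ℚ → ∀ r → ∃[ s ] r ≡ q *ℚ s
divide {q} q≢0 r = 1/ q *ℚ r , sym (begin
  q *ℚ (1/ q *ℚ r)    ≡⟨ QP.*-assoc q (1/ q) r ⟨
  q *ℚ 1/ q *ℚ r      ≡⟨ cong (_*ℚ r) (QP.*-inverseʳ q) ⟩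
  1ℚ *ℚ r             ≡⟨ QP.*-identityˡ r ⟩
  r                   ∎)
  where
  open ≡-Reasoning
  instance q-nonZero = Q.≢-nonZero q≢0

neg-involutive : ∀ p → -ℚ (-ℚ p) ≡ p
neg-involutive (mkℚ -[1+ _ ] _ _) = refl
neg-involutive (mkℚ (ℤ.+ 0) _ _)  = refl
neg-involutive (mkℚ +[1+ _ ] _ _) = refl

neg-<-swap : ∀ {p q} → -ℚ p <ℚ q → -ℚ q <ℚ p
neg-<-swap {p} -p<q = subst (_ <ℚ_) (neg-involutive p) (QP.neg-antimono-< -p<q)

<0⇒0<- : ∀ {r} → r <ℚ 0ℚ → 0ℚ <ℚ -ℚ r
<0⇒0<- = QP.neg-antimono-<

0<-⇒<0 : ∀ {r} → 0ℚ <ℚ -ℚ r → r <ℚ 0ℚ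
0<-⇒<0 {r} 0<-r = subst (_<ℚ 0ℚ) (neg-involutive r) (QP.neg-antimono-< 0<-r)

-- Walking up from a lower bound in steps δ < ε, locatedness at x + δ < x + ε either
-- certifies U (x + ε) or moves on; an upper bound is reached after finitely many steps.
module _ {k} {L U : ℚ → Set k} (located : ∀ q r → q <ℚ r → L q ⊎ U r) where

  located-walk : ∀ {δ ε} → δ <ℚ ε → ∀ N x → L x → U (x +ℚ ℕ→ℚ N *ℚ δ +ℚ ε) →
                 ∃[ p ] L p × U (p +ℚ ε)
  located-walk {δ} {ε} δ<ε zero x Lx Ux =
    x , Lx , subst U (solve 3 (λ x δ ε → x :+ con 0ℚ :* δ :+ ε := x :+ ε) refl x δ ε) Ux
    where open ℚ-Solver
  located-walk {δ} {ε} δ<ε (suc N) x Lx Ux with located (x +ℚ δ) (x +ℚ ε) (QP.+-monoʳ-< x δ<ε)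
  ... | inj₁ Lx+δ = located-walk δ<ε N (x +ℚ δ) Lx+δ (subst U shift Ux)
    where
    open ℚ-Solver
    shift : x +ℚ ℕ→ℚ (suc N) *ℚ δ +ℚ ε ≡ x +ℚ δ +ℚ ℕ→ℚ N *ℚ δ +ℚ ε
    shift = trans (cong (λ n → x +ℚ n *ℚ δ +ℚ ε) (ℕ→ℚ-suc N))
      (solve 4 (λ x n δ ε → x :+ (n :+ con 1ℚ) :* δ :+ ε := x :+ δ :+ n :* δ :+ ε) refl x (ℕ→ℚ N) δ ε)
  ... | inj₂ Ux+ε = x , Lx , Ux+ε

  located⇒approximable : (∀ {q r} → q <ℚ r → U q → U r) →
                         ∀ {q₀ q₁ ε} → L q₀ → U q₁ → 0ℚ <ℚ ε → ∃[ p ] L p × U (p +ℚ ε)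
  located⇒approximable U-up {q₀} {q₁} Lq₀ Uq₁ 0<ε =
    let δ , 0<δ , δ<ε = QP.<-dense 0<ε
        N , q₁-q₀<Nδ = archimedean-* 0<δ (q₁ -ℚ q₀)
    in located-walk δ<ε N q₀ Lq₀ (U-up (QP.<-trans (-<⇒<+ q₁-q₀<Nδ) (p<p+q _ 0<ε)) Uq₁)

module RieszProperties {c ℓ} (R : RieszSpace c ℓ) where
  open RieszSpace R

  +-abelianGroup : AbelianGroup c c
  +-abelianGroup = record
    { Carrier = Carrier ; _≈_ = _≡_ ; _∙_ = _+_ ; ε = 0# ; _⁻¹ = -_
    ; isAbelianGroup = record
      { isGroup = record
        { isMonoid = record
          { isSemigroup = record
            { isMagma = record { isEquivalence = isEquivalence ; ∙-cong = cong₂ _+_ }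
            ; assoc = +-assoc }
          ; identity = comm∧idʳ⇒id +-comm +-identity }
        ; inverse = comm∧invʳ⇒inv +-comm +-inverse
        ; ⁻¹-cong = cong (λ x → - x) }
      ; comm = +-comm } }

  open AbelianGroupProperties +-abelianGroup public
    using (⁻¹-involutive; ⁻¹-∙-comm; ⁻¹-anti-homo‿-; identityˡ-unique; inverseʳ-unique)
    renaming (ε⁻¹≈ε to -0≡0)
  open AbelianGroup +-abelianGroup public using (commutativeMonoid; identityˡ; inverseˡ)

  module +-Solver = CommutativeMonoidSolver commutativeMonoid

  sub-telescope : ∀ a b d → (a - b) + (b - d) ≡ a - d
  sub-telescope a b d = begin
    (a - b) + (b - d)        ≡⟨ +-assoc a (- b) (b - d) ⟩
    a + (- b + (b - d))      ≡⟨ cong (a +_) (+-assoc (- b) b (- d)) ⟨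
    a + ((- b + b) - d)      ≡⟨ cong (λ z → a + (z - d)) (inverseˡ b) ⟩
    a + (0# - d)             ≡⟨ cong (a +_) (identityˡ (- d)) ⟩
    a - d                    ∎
    where open ≡-Reasoning

  +-sub-cancel : ∀ a b → a + b - b ≡ a
  +-sub-cancel a b = trans (+-assoc a b (- b)) (trans (cong (a +_) (+-inverse b)) (+-identity a))

  sub-+-cancel : ∀ a b → a - b + b ≡ a
  sub-+-cancel a b = trans (+-assoc a (- b) b) (trans (cong (a +_) (inverseˡ b)) (+-identity a))

  +-sub-interchange : ∀ a b x y → (a - x) + (b - y) ≡ (a + b) - (x + y)
  +-sub-interchange a b x y = begin
    (a - x) + (b - y)         ≡⟨ +-Solver.solve 4 (λ a b x y → (a ⊕ x) ⊕ (b ⊕ y) ⊜ (a ⊕ b) ⊕ (x ⊕ y))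
                                   refl a b (- x) (- y) ⟩
    (a + b) + (- x + - y)     ≡⟨ cong ((a + b) +_) (⁻¹-∙-comm x y) ⟩
    (a + b) - (x + y)         ∎
    where open ≡-Reasoning
          open +-Solver

  ·-zeroˡ : ∀ a → 0ℚ · a ≡ 0#
  ·-zeroˡ a = identityˡ-unique (0ℚ · a) (0ℚ · a)
    (trans (sym (·-distrib-+ℚ 0ℚ 0ℚ a)) (cong (_· a) (QP.+-identityʳ 0ℚ)))

  ·-zeroʳ : ∀ q → q · 0# ≡ 0#
  ·-zeroʳ q = identityˡ-unique (q · 0#) (q · 0#)
    (trans (sym (·-distrib-+ q 0# 0#)) (cong (q ·_) (+-identity 0#)))

  ·-negˡ : ∀ q a → (-ℚ q) · a ≡ - (q · a)
  ·-negˡ q a = inverseʳ-unique (q · a) ((-ℚ q) · a)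
    (trans (sym (·-distrib-+ℚ q (-ℚ q) a)) (trans (cong (_· a) (QP.+-inverseʳ q)) (·-zeroˡ a)))

  ·-negʳ : ∀ q a → q · (- a) ≡ - (q · a)
  ·-negʳ q a = inverseʳ-unique (q · a) (q · (- a))
    (trans (sym (·-distrib-+ q a (- a))) (trans (cong (q ·_) (+-inverse a)) (·-zeroʳ q)))

  ·-distrib-- : ∀ q a b → q · (a - b) ≡ q · a - q · b
  ·-distrib-- q a b = trans (·-distrib-+ q a (- b)) (cong (q · a +_) (·-negʳ q b))

  ·-distrib--ℚ : ∀ p q a → (p -ℚ q) · a ≡ p · a - q · a
  ·-distrib--ℚ p q a = trans (·-distrib-+ℚ p (-ℚ q) a) (cong (p · a +_) (·-negˡ q a))

  ·-sub-· : ∀ q a s v → q · (a - s · v) ≡ q · a - (q *ℚ s) · v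
  ·-sub-· q a s v = trans (·-distrib-- q a (s · v)) (cong (λ x → q · a - x) (sym (·-assoc q s v)))

  ·-·-sub : ∀ q a s v → q · (s · v - a) ≡ (q *ℚ s) · v - q · a
  ·-·-sub q a s v = trans (·-distrib-- q (s · v) a) (cong (_- q · a) (sym (·-assoc q s v)))

  neg-·-·-sub : ∀ q a s v → (-ℚ q) · (s · v - a) ≡ q · a - (q *ℚ s) · v
  neg-·-·-sub q a s v = trans (·-negˡ q _) (trans (cong -_ (·-·-sub q a s v)) (⁻¹-anti-homo‿- _ _))

  neg-·-sub-· : ∀ q a s v → (-ℚ q) · (a - s · v) ≡ (q *ℚ s) · v - q · a
  neg-·-sub-· q a s v = trans (·-negˡ q _) (trans (cong -_ (·-sub-· q a s v)) (⁻¹-anti-homo‿- _ _))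

  0·-sub : ∀ a r v → 0ℚ · a - r · v ≡ (-ℚ r) · v
  0·-sub a r v = trans (cong (_- r · v) (·-zeroˡ a)) (trans (identityˡ _) (sym (·-negˡ r v)))

  sub-0· : ∀ a r v → r · v - 0ℚ · a ≡ r · v
  sub-0· a r v = trans (cong (λ x → r · v - x) (·-zeroˡ a)) (trans (cong (r · v +_) -0≡0) (+-identity (r · v)))

  ≤⇒-≤0 : ∀ {a b} → a ≤ b → a - b ≤ 0#
  ≤⇒-≤0 {a} {b} a≤b = subst (a - b ≤_) (+-inverse b) (+-mono-≤ (- b) a≤b)

  +-monoˡ-≤ : ∀ {a b} d → a ≤ b → d + a ≤ d + b
  +-monoˡ-≤ {a} {b} d a≤b = subst₂ _≤_ (+-comm a d) (+-comm b d) (+-mono-≤ d a≤b)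

  neg-antimono-≤ : ∀ {a b} → a ≤ b → - b ≤ - a
  neg-antimono-≤ {a} {b} a≤b = subst₂ _≤_ (cancel a (- b))
    (trans (cong (b +_) (+-comm (- a) (- b))) (cancel b (- a)))
    (+-mono-≤ ((- a) + (- b)) a≤b)
    where
    cancel : ∀ x y → x + ((- x) + y) ≡ y
    cancel x y = trans (sym (+-assoc x (- x) y)) (trans (cong (_+ y) (+-inverse x)) (identityˡ y))

  +-distribʳ-∨ : ∀ a b d → (a ∨ b) + d ≡ (a + d) ∨ (b + d)
  +-distribʳ-∨ a b d = ≤-antisym
    (subst ((a ∨ b) + d ≤_) (sub-+-cancel ((a + d) ∨ (b + d)) d)
      (+-mono-≤ d (∨-least (below a (∨-upperˡ (a + d) (b + d))) (below b (∨-upperʳ (a + d) (b + d))))))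
    (∨-least (+-mono-≤ d (∨-upperˡ a b)) (+-mono-≤ d (∨-upperʳ a b)))
    where
    below : ∀ x {y} → x + d ≤ y → x ≤ y - d
    below x {y} x+d≤y = subst (_≤ y - d) (+-sub-cancel x d) (+-mono-≤ (- d) x+d≤y)

module MaxModelProperties {c ℓ k} (R : RieszSpace c ℓ) {u} (m : MaxModel R u k) where
  open RieszSpace R
  open RieszProperties R
  open MaxModel m

  D-+ : ∀ {a b} → D a → D b → D (a + b)
  D-+ {a} {b} Da Db with D-add (a + b) (- b) (subst D (sym (+-sub-cancel a b)) Da)
  ... | inj₁ Da+b = Da+b
  ... | inj₂ D-b  = ⊥-elim (D-neg b Db D-b)

  D-mono : ∀ {a b} → a ≤ b → D a → D b
  D-mono {a} {b} a≤b Da with D-add b (a - b) (subst D (trans (sym (sub-+-cancel a b)) (+-comm _ b)) Da)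
  ... | inj₁ Db   = Db
  ... | inj₂ Da-b = ⊥-elim (D-nonpos (a - b) (≤⇒-≤0 a≤b) Da-b)

  ¬D-sub-self : ∀ a → ¬ D (a - a)
  ¬D-sub-self a = D-nonpos (a - a) (≤⇒-≤0 (≤-refl a))

  ·-suc : ∀ n a → ℕ→ℚ (suc n) · a ≡ ℕ→ℚ n · a + a
  ·-suc n a = trans (cong (_· a) (ℕ→ℚ-suc n))
    (trans (·-distrib-+ℚ (ℕ→ℚ n) 1ℚ a) (cong (ℕ→ℚ n · a +_) (·-identity a)))

  D-·ℕ : ∀ n {a} → D a → D (ℕ→ℚ (suc n) · a)
  D-·ℕ zero    {a} Da = subst D (sym (·-identity a)) Da
  D-·ℕ (suc n) {a} Da = subst D (sym (·-suc (suc n) a)) (D-+ (D-·ℕ n Da) Da)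

  D-·ℕ⁻¹ : ∀ n {a} → D (ℕ→ℚ (suc n) · a) → D a
  D-·ℕ⁻¹ zero    {a} D1a = subst D (·-identity a) D1a
  D-·ℕ⁻¹ (suc n) {a} Dna with D-add _ a (subst D (·-suc (suc n) a) Dna)
  ... | inj₁ Dn-1a = D-·ℕ⁻¹ n Dn-1a
  ... | inj₂ Da    = Da

  -- with q = (1 + n)/(1 + d): D a gives D ((1 + n)·a) = D ((1 + d)·(q·a)), hence D (q·a)
  D-·-pos : ∀ {q} → 0ℚ <ℚ q → ∀ {a} → D a → D (q · a)
  D-·-pos {q} 0<q {a} Da =
    let d , n , [1+d]q≡1+n = positive⇒ratio 0<q
    in D-·ℕ⁻¹ d (subst D (trans (cong (_· a) (sym [1+d]q≡1+n)) (·-assoc _ q a)) (D-·ℕ n Da))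

  D-·-pos⁻¹ : ∀ {q} → 0ℚ <ℚ q → ∀ {a} → D (q · a) → D a
  D-·-pos⁻¹ {q} 0<q {a} Dqa = subst D 1/q·q·a≡a (D-·-pos 0<1/q Dqa)
    where
    instance
      q-positive = Q.positive 0<q
      q-nonZero  = QP.pos⇒nonZero q
    0<1/q : 0ℚ <ℚ 1/ q
    0<1/q = QP.positive⁻¹ (1/ q) {{QP.1/pos⇒pos q}}
    1/q·q·a≡a : (1/ q) · (q · a) ≡ a
    1/q·q·a≡a = trans (sym (·-assoc (1/ q) q a)) (trans (cong (_· a) (QP.*-inverseˡ q)) (·-identity a))

  D-rescale : ∀ {q} → 0ℚ <ℚ q → ∀ {a b} → q · a ≡ b → D a → D b
  D-rescale 0<q refl = D-·-pos 0<q

  D-rescale⁻¹ : ∀ {q} → 0ℚ <ℚ q → ∀ {a b} → q · a ≡ b → D b → D a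
  D-rescale⁻¹ 0<q refl = D-·-pos⁻¹ 0<q

  D-unit : ∀ {p} → 0ℚ <ℚ p → D (p · u)
  D-unit 0<p = D-·-pos 0<p D-one

  D-unit⁻¹ : ∀ {p} → D (p · u) → 0ℚ <ℚ p
  D-unit⁻¹ {p} Dpu with QP.<-cmp 0ℚ p
  ... | tri< 0<p _ _  = 0<p
  ... | tri≈ _ refl _ = ⊥-elim (D-nonpos (0ℚ · u) (subst (_≤ 0#) (sym (·-zeroˡ u)) (≤-refl 0#)) Dpu)
  ... | tri> _ _ p<0  = ⊥-elim (D-neg _ Dpu (subst D (·-negˡ p u) (D-unit (<0⇒0<- p<0))))

module Representation {c ℓ k} (R : RieszSpace c ℓ) {u} (u-strong : IsStrongUnit R u) (m : MaxModel R u k) where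
  open RieszSpace R
  open RieszProperties R
  open MaxModel m
  open MaxModelProperties R m

  σm : Carrier → Cut k
  σm = σ R m

  neg-sub-unit : ∀ a s → - a - (-ℚ s) · u ≡ s · u - a
  neg-sub-unit a s = begin
    - a - (-ℚ s) · u   ≡⟨ cong (λ x → - a - x) (·-negˡ s u) ⟩
    - a - - (s · u)    ≡⟨ cong (- a +_) (⁻¹-involutive (s · u)) ⟩
    - a + s · u        ≡⟨ +-comm (- a) (s · u) ⟩
    s · u - a          ∎
    where open ≡-Reasoning

  U⇒L-neg : ∀ {a s} → U (σm a) s → L (σm (- a)) (-ℚ s)
  U⇒L-neg {a} {s} = subst D (sym (neg-sub-unit a s))

  L-neg⇒U : ∀ {a s} → L (σm (- a)) (-ℚ s) → U (σm a) s
  L-neg⇒U {a} {s} = subst D (neg-sub-unit a s)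

  L-neg⇒U-neg : ∀ {a r} → L (σm (- a)) r → U (σm a) (-ℚ r)
  L-neg⇒U-neg {a} {r} Lr = L-neg⇒U (subst (L (σm (- a))) (sym (neg-involutive r)) Lr)

  L-inhabited : ∀ a → ∃[ r ] L (σm a) r
  L-inhabited a = -ℚ (N +ℚ 1ℚ) , subst D a+Nu+u≡ (D-mono u≤a+Nu+u D-one)
    where
    n = proj₁ (u-strong a)
    N = ℕ→ℚ n
    0≤a+Nu : 0# ≤ a + N · u
    0≤a+Nu = subst (_≤ a + N · u) (inverseˡ (N · u)) (+-mono-≤ (N · u) (proj₁ (proj₂ (u-strong a))))
    u≤a+Nu+u : u ≤ a + N · u + u
    u≤a+Nu+u = subst (_≤ a + N · u + u) (identityˡ u) (+-mono-≤ u 0≤a+Nu)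
    a+Nu+u≡ : a + N · u + u ≡ a - (-ℚ (N +ℚ 1ℚ)) · u
    a+Nu+u≡ = begin
      a + N · u + u               ≡⟨ +-assoc a (N · u) u ⟩
      a + (N · u + u)             ≡⟨ cong (λ x → a + (N · u + x)) (·-identity u) ⟨
      a + (N · u + 1ℚ · u)        ≡⟨ cong (a +_) (·-distrib-+ℚ N 1ℚ u) ⟨
      a + (N +ℚ 1ℚ) · u           ≡⟨ cong (a +_) (⁻¹-involutive _) ⟨
      a - - ((N +ℚ 1ℚ) · u)       ≡⟨ cong (λ x → a - x) (·-negˡ (N +ℚ 1ℚ) u) ⟨
      a - (-ℚ (N +ℚ 1ℚ)) · u      ∎
      where open ≡-Reasoning

  L-rounded⇒ : ∀ a q → L (σm a) q → ∃[ r ] (q <ℚ r × L (σm a) r)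
  L-rounded⇒ a q Lq =
    let s , 0<s , Ds = D-round⇒ _ Lq
    in q +ℚ s , p<p+q q 0<s , subst D (a-qu-su≡ s) Ds
    where
    a-qu-su≡ : ∀ s → a - q · u - s · u ≡ a - (q +ℚ s) · u
    a-qu-su≡ s = trans (+-assoc a _ _)
      (cong (a +_) (trans (⁻¹-∙-comm (q · u) (s · u)) (cong -_ (sym (·-distrib-+ℚ q s u)))))

  L-rounded⇐ : ∀ a q → ∃[ r ] (q <ℚ r × L (σm a) r) → L (σm a) q
  L-rounded⇐ a q (r , q<r , Lr) = subst D telescope (D-+ Lr (D-unit (<⇒0<- q<r)))
    where
    telescope : a - r · u + (r -ℚ q) · u ≡ a - q · u
    telescope = trans (cong (a - r · u +_) (·-distrib--ℚ r q u)) (sub-telescope a (r · u) (q · u))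

  disjoint : ∀ a q → L (σm a) q → U (σm a) q → ⊥
  disjoint a q Lq Uq = D-neg _ Lq (subst D (sym (⁻¹-anti-homo‿- a (q · u))) Uq)

  located : ∀ a q r → q <ℚ r → L (σm a) q ⊎ U (σm a) r
  located a q r q<r = D-add _ _ (subst D split (D-unit (<⇒0<- q<r)))
    where
    split : (r -ℚ q) · u ≡ a - q · u + (r · u - a)
    split = trans (·-distrib--ℚ r q u) (trans (sym (sub-telescope (r · u) a (q · u))) (+-comm _ _))

  U-rounded⇒ : ∀ a q → U (σm a) q → ∃[ r ] (r <ℚ q × U (σm a) r)
  U-rounded⇒ a q Uq = let r , -q<r , Lr = L-rounded⇒ (- a) (-ℚ q) (U⇒L-neg Uq)
                      in -ℚ r , neg-<-swap -q<r , L-neg⇒U-neg Lr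

  U-rounded⇐ : ∀ a q → ∃[ r ] (r <ℚ q × U (σm a) r) → U (σm a) q
  U-rounded⇐ a q (r , r<q , Ur) =
    L-neg⇒U (L-rounded⇐ (- a) (-ℚ q) (-ℚ r , QP.neg-antimono-< r<q , U⇒L-neg Ur))

  σ-isDedekind : ∀ a → IsDedekind (σm a)
  σ-isDedekind a = record
    { L-inhabited = L-inhabited a
    ; U-inhabited = let r , Lr = L-inhabited (- a) in -ℚ r , L-neg⇒U-neg Lr
    ; L-rounded⇒  = L-rounded⇒ a
    ; L-rounded⇐  = L-rounded⇐ a
    ; U-rounded⇒  = U-rounded⇒ a
    ; U-rounded⇐  = U-rounded⇐ a
    ; disjoint    = disjoint a
    ; located     = located a
    }

  approximate : ∀ a {ε} → 0ℚ <ℚ ε → ∃[ p ] (L (σm a) p × U (σm a) (p +ℚ ε))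
  approximate a =
    let q₀ , Lq₀ = σ-isDedekind a .IsDedekind.L-inhabited
        q₁ , Uq₁ = σ-isDedekind a .IsDedekind.U-inhabited
    in located⇒approximable (located a) (λ {q} {r} q<r Uq → U-rounded⇐ a r (q , q<r , Uq)) Lq₀ Uq₁

  L-+-split : ∀ a b {s r} → L (σm (a + b)) r → U (σm a) s → L (σm b) (r -ℚ s)
  L-+-split a b {s} {r} Lr Us = [ (λ Ls → ⊥-elim (disjoint a s Ls Us)) , id ]′ (D-add _ _ (subst D (sym split) Lr))
    where
    split : a - s · u + (b - (r -ℚ s) · u) ≡ a + b - r · u
    split = begin
      a - s · u + (b - (r -ℚ s) · u)      ≡⟨ +-sub-interchange a b _ _ ⟩
      a + b - (s · u + (r -ℚ s) · u)      ≡⟨ cong (λ x → a + b - x) (·-distrib-+ℚ s _ u) ⟨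
      a + b - (s +ℚ (r -ℚ s)) · u         ≡⟨ cong (λ x → a + b - x · u)
                                                  (solve 2 (λ s r → s :+ (r :- s) := r) refl s r) ⟩
      a + b - r · u                       ∎
      where open ≡-Reasoning
            open ℚ-Solver

  +-L⇒ : ∀ a b r → L (σm (a + b)) r → L (σm a +ℝ σm b) r
  +-L⇒ a b r Lr =
    let r′ , r<r′ , Lr′ = L-rounded⇒ (a + b) r Lr
        t , r<t , t<r′ = QP.<-dense r<r′
        p , Lp , Up+ε = approximate a (<⇒0<- t<r′)
    in p , _ , Lp , L-+-split a b Lr′ Up+ε , subst (r <ℚ_) (sym (p+q≡t p r′ t)) r<t
    where
    p+q≡t : ∀ p r′ t → p +ℚ (r′ -ℚ (p +ℚ (r′ -ℚ t))) ≡ t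
    p+q≡t = solve 3 (λ p r′ t → p :+ (r′ :- (p :+ (r′ :- t))) := t) refl
      where open ℚ-Solver

  +-L⇐ : ∀ a b r → L (σm a +ℝ σm b) r → L (σm (a + b)) r
  +-L⇐ a b r (p , q , Lp , Lq , r<p+q) = L-rounded⇐ (a + b) r (p +ℚ q , r<p+q , subst D merge (D-+ Lp Lq))
    where
    merge : a - p · u + (b - q · u) ≡ a + b - (p +ℚ q) · u
    merge = trans (+-sub-interchange a b _ _) (cong (λ x → a + b - x) (sym (·-distrib-+ℚ p q u)))

  +-U⇒ : ∀ a b r → U (σm (a + b)) r → U (σm a +ℝ σm b) r
  +-U⇒ a b r Ur =
    let p , q , Lp , Lq , -r<p+q =
          +-L⇒ (- a) (- b) (-ℚ r) (subst (λ x → L (σm x) (-ℚ r)) (sym (⁻¹-∙-comm a b)) (U⇒L-neg Ur))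
    in -ℚ p , -ℚ q , L-neg⇒U-neg Lp , L-neg⇒U-neg Lq ,
       subst (_<ℚ r) (QP.neg-distrib-+ p q) (neg-<-swap -r<p+q)

  +-U⇐ : ∀ a b r → U (σm a +ℝ σm b) r → U (σm (a + b)) r
  +-U⇐ a b r (p , q , Up , Uq , p+q<r) = L-neg⇒U (subst (λ x → L (σm x) (-ℚ r)) (⁻¹-∙-comm a b)
    (+-L⇐ (- a) (- b) (-ℚ r) (-ℚ p , -ℚ q , U⇒L-neg Up , U⇒L-neg Uq ,
      subst (-ℚ r <ℚ_) (QP.neg-distrib-+ p q) (QP.neg-antimono-< p+q<r))))

  σ-+ : ∀ a b → σm (a + b) ≃ℝ (σm a +ℝ σm b)
  σ-+ a b r = (+-L⇒ a b r , +-L⇐ a b r) , (+-U⇒ a b r , +-U⇐ a b r)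

  D-∨-sub : ∀ a b d → D ((a ∨ b) - d) → D (a - d) ⊎ D (b - d)
  D-∨-sub a b d D∨ = D-join⇒ _ _ (subst D (+-distribʳ-∨ a b (- d)) D∨)

  D-∨-subˡ : ∀ a b → D ((a ∨ b) - a) → D (b - a)
  D-∨-subˡ a b D∨ = [ ⊥-elim ∘ ¬D-sub-self a , id ]′ (D-∨-sub a b a D∨)

  D-∨-subʳ : ∀ a b → D ((a ∨ b) - b) → D (a - b)
  D-∨-subʳ a b D∨ = [ id , ⊥-elim ∘ ¬D-sub-self b ]′ (D-∨-sub a b b D∨)

  -- s − a = (s − a ∨ b) + (a ∨ b − a); failing U, both D (b − a) and D (a − b) would hold
  ∨-U⇐ : ∀ a b s → U (σm a) s → U (σm b) s → U (σm (a ∨ b)) s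
  ∨-U⇐ a b s Ua Ub with D-add _ _ (subst D (sym (sub-telescope (s · u) (a ∨ b) a)) Ua)
                      | D-add _ _ (subst D (sym (sub-telescope (s · u) (a ∨ b) b)) Ub)
  ... | inj₁ U∨ | _       = U∨
  ... | inj₂ _  | inj₁ U∨ = U∨
  ... | inj₂ Da | inj₂ Db =
    ⊥-elim (D-neg _ (D-∨-subˡ a b Da) (subst D (sym (⁻¹-anti-homo‿- b a)) (D-∨-subʳ a b Db)))

  σ-∨ : ∀ a b → σm (a ∨ b) ≃ℝ (σm a ∨ℝ σm b)
  σ-∨ a b r =
      ( D-∨-sub a b (r · u)
      , (λ La⊎Lb → subst D (sym (+-distribʳ-∨ a b _)) (D-join⇐ _ _ La⊎Lb)) )
    , ( (λ U∨ → U-antitone (∨-upperˡ a b) U∨ , U-antitone (∨-upperʳ a b) U∨)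
      , (λ (Ua , Ub) → ∨-U⇐ a b r Ua Ub) )
    where
    U-antitone : ∀ {x y} → x ≤ y → U (σm y) r → U (σm x) r
    U-antitone x≤y = D-mono (+-monoˡ-≤ (r · u) (neg-antimono-≤ x≤y))

  σ-unit : σm u ≃ℝ ℚ→ℝ 1ℚ
  σ-unit r =
      ( (λ Lr → lift (0<-⇒< (D-unit⁻¹ (subst D (sym [1-r]u≡) Lr))))
      , (λ r<1 → subst D [1-r]u≡ (D-unit (<⇒0<- (lower r<1)))) )
    , ( (λ Ur → lift (0<-⇒< (D-unit⁻¹ (subst D (sym [r-1]u≡) Ur))))
      , (λ 1<r → subst D [r-1]u≡ (D-unit (<⇒0<- (lower 1<r)))) )
    where
    [1-r]u≡ : (1ℚ -ℚ r) · u ≡ u - r · u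
    [1-r]u≡ = trans (·-distrib--ℚ 1ℚ r u) (cong (λ x → x - r · u) (·-identity u))
    [r-1]u≡ : (r -ℚ 1ℚ) · u ≡ r · u - u
    [r-1]u≡ = trans (·-distrib--ℚ r 1ℚ u) (cong (λ x → r · u - x) (·-identity u))

  ·-L⇒ : ∀ q a r → L (σm (q · a)) r → L (q ·ℝ σm a) r
  ·-L⇒ q a r Lr with QP.<-cmp q 0ℚ
  ... | tri≈ _ refl _ = inj₂ (inj₁ (lift (refl , 0<-⇒<0 (D-unit⁻¹ (subst D (0·-sub a r u) Lr)))))
  ... | tri> _ q≢0 0<q with divide q≢0 r
  ...   | s , refl = inj₁ (0<q , s , D-rescale⁻¹ 0<q (·-sub-· q a s u) Lr , refl)
  ·-L⇒ q a r Lr | tri< q<0 q≢0 _ with divide q≢0 r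
  ...   | s , refl = inj₂ (inj₂ (q<0 , s , D-rescale⁻¹ (<0⇒0<- q<0) (neg-·-·-sub q a s u) Lr , refl))

  ·-L⇐ : ∀ q a r → L (q ·ℝ σm a) r → L (σm (q · a)) r
  ·-L⇐ q a _ (inj₁ (0<q , s , Ls , refl))           = D-rescale 0<q (·-sub-· q a s u) Ls
  ·-L⇐ _ a r (inj₂ (inj₁ (lift (refl , r<0))))      = subst D (sym (0·-sub a r u)) (D-unit (<0⇒0<- r<0))
  ·-L⇐ q a _ (inj₂ (inj₂ (q<0 , s , Us , refl)))    = D-rescale (<0⇒0<- q<0) (neg-·-·-sub q a s u) Us

  ·-U⇒ : ∀ q a r → U (σm (q · a)) r → U (q ·ℝ σm a) r
  ·-U⇒ q a r Ur with QP.<-cmp q 0ℚ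
  ... | tri≈ _ refl _ = inj₂ (inj₁ (lift (refl , D-unit⁻¹ (subst D (sub-0· a r u) Ur))))
  ... | tri> _ q≢0 0<q with divide q≢0 r
  ...   | s , refl = inj₁ (0<q , s , D-rescale⁻¹ 0<q (·-·-sub q a s u) Ur , refl)
  ·-U⇒ q a r Ur | tri< q<0 q≢0 _ with divide q≢0 r
  ...   | s , refl = inj₂ (inj₂ (q<0 , s , D-rescale⁻¹ (<0⇒0<- q<0) (neg-·-sub-· q a s u) Ur , refl))

  ·-U⇐ : ∀ q a r → U (q ·ℝ σm a) r → U (σm (q · a)) r
  ·-U⇐ q a _ (inj₁ (0<q , s , Us , refl))           = D-rescale 0<q (·-·-sub q a s u) Us
  ·-U⇐ _ a r (inj₂ (inj₁ (lift (refl , 0<r))))      = subst D (sym (sub-0· a r u)) (D-unit 0<r)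
  ·-U⇐ q a _ (inj₂ (inj₂ (q<0 , s , Ls , refl)))    = D-rescale (<0⇒0<- q<0) (neg-·-sub-· q a s u) Ls

  σ-· : ∀ q a → σm (q · a) ≃ℝ (q ·ℝ σm a)
  σ-· q a r = (·-L⇒ q a r , ·-L⇐ q a r) , (·-U⇒ q a r , ·-U⇐ q a r)

proposition2p6 : ∀ {c ℓ k : Level} (R : RieszSpace c ℓ) (u : RieszSpace.Carrier R)
    → IsStrongUnit R u → (m : MaxModel R u k) → IsRepresentation R u (σ R m)
proposition2p6 R u u-strong m = σ-isDedekind , σ-+ , σ-· , σ-∨ , σ-unit
  where open Representation R u-strong m
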